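{- Let $M$ be a fixed integer. Then for any $a,b,c\in\mathbb{Z}$ the set $\mathcal{R}_H(a,b,c)\cap(-\infty,M]$ is finite.
   Context: Define three maps $\mathbb{Z}^3\to\mathbb{Z}^3$ by $H'(x,y,z)=(-x+1+y+z,\,y,\,z)$, $H''(x,y,z)=(x,\,-y+1+z+x,\,z)$, $H'''(x,y,z)=(x,\,y,\,-z+1+x+y)$. For $(a,b,c)\in\mathbb{Z}^3$, let $\mathcal{T}_H(a,b,c)$ be the set of all triples obtained from $(a,b,c)$ by applying any finite sequence (possibly empty) of the maps $H',H'',H'''$, in any order. Let $\mathcal{R}_H(a,b,c)=\{m\in\mathbb{Z}: m \text{ is a component of some triple in } \mathcal{T}_H(a,b,c)\}$ (the integers represented by $(a,b,c)$). -}

module Defs where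

open import Data.Integer using (ℤ; _+_; -_; _≤_; 1ℤ)
open import Data.Product using (Σ; _×_; _,_; ∃-syntax)
open import Data.Sum using (_⊎_)
open import Data.List using (List)
open import Data.List.Membership.Propositional using (_∈_)
open import Relation.Binary.PropositionalEquality using (_≡_)

Triple : Set
Triple = ℤ × ℤ × ℤ

H′ : Triple → Triple
H′ (x , y , z) = (- x + 1ℤ + y + z , y , z)

H″ : Triple → Triple
H″ (x , y , z) = (x , - y + 1ℤ + z + x , z)

H‴ : Triple → Triple
H‴ (x , y , z) = (x , y , - z + 1ℤ + x + y)

data Reach (t : Triple) : Triple → Set where
  start : Reach t t
  step′ : ∀ {s} → Reach t s → Reach t (H′ s)
  step″ : ∀ {s} → Reach t s → Reach t (H″ s)
  step‴ : ∀ {s} → Reach t s → Reach t (H‴ s)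

IsComponent : ℤ → Triple → Set
IsComponent m (x , y , z) = (m ≡ x) ⊎ (m ≡ y) ⊎ (m ≡ z)

Represented : Triple → ℤ → Set
Represented t m = ∃[ s ] (Reach t s × IsComponent m s)

FiniteSet : (ℤ → Set) → Set
FiniteSet P = Σ (List ℤ) (λ L → ∀ (m : ℤ) → P m → m ∈ L)

-- The quadratic form Q below is invariant under H′, H″, H‴, and whenever m is a coordinate
-- of a triple s, 6 m + 2 + 2 Q(s) is a sum of three squares. Hence every integer represented
-- by t is at least -(2 + 2 Q(t))/6, so those up to M lie in a finite interval.
module Submission where

open import Defs
open import Data.Integer using (ℤ; _≤_; _+_; _*_; _-_; -_; +_; -[1+_]; ∣_∣; 0ℤ; 1ℤ; +≤+; -≤+)
import Data.Integer.Properties as ℤ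
open import Data.Integer.Tactic.RingSolver using (solve-∀)
open import Data.Nat as ℕ using (suc; s≤s)
open import Data.Product using (_×_; _,_)
open import Data.Sum using (inj₁; inj₂)
open import Data.List using (applyUpTo)
open import Data.List.Membership.Propositional using (_∈_)
open import Data.List.Membership.Propositional.Properties using (∈-applyUpTo⁺)
open import Function using (_∘_)
open import Relation.Binary.PropositionalEquality using (_≡_; refl; sym; trans; cong; subst)
open Relation.Binary.PropositionalEquality.≡-Reasoning

Q : Triple → ℤ
Q (x , y , z) = x * x + y * y + z * z - x * y - y * z - z * x - x - y - z

rotate : Triple → Triple
rotate (x , y , z) = (y , z , x)

Q-rotate : ∀ t → Q (rotate t) ≡ Q t
Q-rotate (x , y , z) = expanded x y z
  where
  expanded : ∀ x y z →
    y * y + z * z + x * x - y * z - z * x - x * y - y - z - x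
      ≡ x * x + y * y + z * z - x * y - y * z - z * x - x - y - z
  expanded = solve-∀

-- Q is quadratic in x with root sum 1 + y + z, and H′ swaps the two roots.
Q-H′ : ∀ t → Q (H′ t) ≡ Q t
Q-H′ (x , y , z) = expanded x y z
  where
  expanded : ∀ x y z → let x′ = - x + 1ℤ + y + z in
    x′ * x′ + y * y + z * z - x′ * y - y * z - z * x′ - x′ - y - z
      ≡ x * x + y * y + z * z - x * y - y * z - z * x - x - y - z
  expanded = solve-∀

-- H″ and H‴ are conjugates of H′ by rotations.
Q-H″ : ∀ t → Q (H″ t) ≡ Q t
Q-H″ t = begin
  Q (rotate (rotate (H′ (rotate t)))) ≡⟨ Q-rotate (rotate (H′ (rotate t))) ⟩
  Q (rotate (H′ (rotate t)))          ≡⟨ Q-rotate (H′ (rotate t)) ⟩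
  Q (H′ (rotate t))                   ≡⟨ Q-H′ (rotate t) ⟩
  Q (rotate t)                        ≡⟨ Q-rotate t ⟩
  Q t                                 ∎

Q-H‴ : ∀ t → Q (H‴ t) ≡ Q t
Q-H‴ t = begin
  Q (rotate (H′ (rotate (rotate t)))) ≡⟨ Q-rotate (H′ (rotate (rotate t))) ⟩
  Q (H′ (rotate (rotate t)))          ≡⟨ Q-H′ (rotate (rotate t)) ⟩
  Q (rotate (rotate t))               ≡⟨ Q-rotate (rotate t) ⟩
  Q (rotate t)                        ≡⟨ Q-rotate t ⟩
  Q t                                 ∎

Q-Reach : ∀ {t s} → Reach t s → Q s ≡ Q t
Q-Reach start             = refl
Q-Reach (step′ {s} t↝s) = trans (Q-H′ s) (Q-Reach t↝s)
Q-Reach (step″ {s} t↝s) = trans (Q-H″ s) (Q-Reach t↝s)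
Q-Reach (step‴ {s} t↝s) = trans (Q-H‴ s) (Q-Reach t↝s)

square-nonNeg : ∀ i → 0ℤ ≤ i * i
square-nonNeg (+ n)    = subst (0ℤ ≤_) (ℤ.pos-* n n) (+≤+ ℕ.z≤n)
square-nonNeg -[1+ n ] = +≤+ ℕ.z≤n

sumOfSquares-nonNeg : ∀ i j k → 0ℤ ≤ i * i + j * j + k * k
sumOfSquares-nonNeg i j k =
  ℤ.+-mono-≤ (ℤ.+-mono-≤ (square-nonNeg i) (square-nonNeg j)) (square-nonNeg k)

-- Stated as a difference so that `0≤i-j⇒j≤i` turns it into the lower bound below.
sixTimesFirst-sumOfSquares : ∀ x y z →
  let q = x * x + y * y + z * z - x * y - y * z - z * x - x - y - z in
  + 6 * x - - (+ 2 + + 2 * q)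
    ≡ (y - x - 1ℤ) * (y - x - 1ℤ) + (z - x - 1ℤ) * (z - x - 1ℤ) + (y - z) * (y - z)
sixTimesFirst-sumOfSquares = solve-∀

sixTimesFirst-lowerBound : ∀ x y z → - (+ 2 + + 2 * Q (x , y , z)) ≤ + 6 * x
sixTimesFirst-lowerBound x y z = ℤ.0≤i-j⇒j≤i
  (subst (0ℤ ≤_) (sym (sixTimesFirst-sumOfSquares x y z))
         (sumOfSquares-nonNeg (y - x - 1ℤ) (z - x - 1ℤ) (y - z)))

sixTimesComponent-lowerBound : ∀ m s → IsComponent m s → - (+ 2 + + 2 * Q s) ≤ + 6 * m
sixTimesComponent-lowerBound m (x , y , z) (inj₁ refl) = sixTimesFirst-lowerBound x y z
sixTimesComponent-lowerBound m s@(x , y , z) (inj₂ (inj₁ refl)) =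
  subst (λ q → - (+ 2 + + 2 * q) ≤ + 6 * m) (Q-rotate s) (sixTimesFirst-lowerBound y z x)
sixTimesComponent-lowerBound m s@(x , y , z) (inj₂ (inj₂ refl)) =
  subst (λ q → - (+ 2 + + 2 * q) ≤ + 6 * m) (trans (Q-rotate (rotate s)) (Q-rotate s))
        (sixTimesFirst-lowerBound z x y)

i≤+∣i∣ : ∀ i → i ≤ + ∣ i ∣
i≤+∣i∣ (+ n)    = ℤ.≤-refl
i≤+∣i∣ -[1+ n ] = -≤+

-- For negative m the multiple + suc n * m lies below m; for m ≥ 0 the bound is trivial.
lowerBound-of-multiple : ∀ n m k → - k ≤ + suc n * m → - + ∣ k ∣ ≤ m
lowerBound-of-multiple n (+ j)    k _        = ℤ.neg-≤-pos
lowerBound-of-multiple n -[1+ j ] k -k≤[n+1]m = ℤ.≤-trans (ℤ.neg-mono-≤ (i≤+∣i∣ k))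
  (ℤ.≤-trans -k≤[n+1]m
    (subst (+ suc n * -[1+ j ] ≤_) (ℤ.*-identityˡ -[1+ j ])
      (ℤ.*-monoʳ-≤-nonPos -[1+ j ] {1ℤ} {+ suc n} (+≤+ (s≤s ℕ.z≤n)))))

represented-lowerBound : ∀ t m → Represented t m → - + ∣ + 2 + + 2 * Q t ∣ ≤ m
represented-lowerBound t m (s , t↝s , m∈s) = lowerBound-of-multiple 5 m _
  (subst (λ q → - (+ 2 + + 2 * q) ≤ + 6 * m) (Q-Reach t↝s)
         (sixTimesComponent-lowerBound m s m∈s))

FiniteSet-mono : {P R : ℤ → Set} → (∀ m → P m → R m) → FiniteSet R → FiniteSet P
FiniteSet-mono P⊆R (L , R⊆L) = L , λ m → R⊆L m ∘ P⊆R m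

∣∣-mono-≤-nonNeg : ∀ {i j} → 0ℤ ≤ i → i ≤ j → ∣ i ∣ ℕ.≤ ∣ j ∣
∣∣-mono-≤-nonNeg (+≤+ _) (+≤+ p) = p

i+[j-i]≡j : ∀ i j → i + (j - i) ≡ j
i+[j-i]≡j = solve-∀

interval-finite : ∀ L M → FiniteSet (λ m → L ≤ m × m ≤ M)
interval-finite L M = applyUpTo (λ k → L + + k) (suc ∣ M - L ∣) , member
  where
  member : ∀ m → L ≤ m × m ≤ M → m ∈ applyUpTo (λ k → L + + k) (suc ∣ M - L ∣)
  member m (L≤m , m≤M) = subst (_∈ _) L+[m-L]≡m
    (∈-applyUpTo⁺ (λ k → L + + k) (s≤s (∣∣-mono-≤-nonNeg 0≤m-L (ℤ.+-monoˡ-≤ (- L) m≤M))))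
    where
    0≤m-L : 0ℤ ≤ m - L
    0≤m-L = ℤ.i≤j⇒0≤j-i L≤m
    L+[m-L]≡m : L + + ∣ m - L ∣ ≡ m
    L+[m-L]≡m = trans (cong (λ d → L + d) (ℤ.0≤i⇒+∣i∣≡i 0≤m-L)) (i+[j-i]≡j L m)

theorem1p1 : (M a b c : ℤ) →
    FiniteSet (λ m → Represented (a , b , c) m × m ≤ M)
theorem1p1 M a b c = FiniteSet-mono
  (λ m (represented , m≤M) → represented-lowerBound (a , b , c) m represented , m≤M)
  (interval-finite _ M)
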